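{- Let $a,b,c,d \in \mathbb{Q}$ satisfy $$a^4+b^4+c^4+d^4=(a+b+c+d)^4,$$ and suppose the solution is non-trivial, i.e. at least three of $a,b,c,d$ are non-zero. Put $$F=a^2+ab+b^2,\qquad G=c^2+cd+d^2,\qquad H=(a+b)^2+(a+b)(c+d)+(c+d)^2 .$$ Then $G\neq 0$, $H-F\neq 0$, and the common value $$t=\frac{H+F}{G}=\frac{G}{H-F}$$ is a rational number satisfying $t>0$.
   Context: For such a solution one has $G^2=H^2-F^2=(H+F)(H-F)$, so the two fractions defining $t$ are equal whenever their denominators are non-zero. The Diophantine equation $a^4+b^4+c^4+d^4=(a+b+c+d)^4$ is called the Jacobi–Madden equation. -}

module Defs where

open import Data.Nat using (ℕ)
open import Data.Rational using (ℚ; 0ℚ; _+_; _*_; _-_; _≟_; _÷_; NonZero; ≢-nonZero)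
open import Relation.Nullary using (yes; no)
open import Relation.Binary.PropositionalEquality using (_≢_)

nz : ℚ → ℕ
nz x with x ≟ 0ℚ
... | yes _ = 0
... | no  _ = 1

numNonZero : ℚ → ℚ → ℚ → ℚ → ℕ
numNonZero a b c d = nz a Data.Nat.+ nz b Data.Nat.+ nz c Data.Nat.+ nz d

pow4 : ℚ → ℚ
pow4 x = x * x * x * x

JacobiMadden : ℚ → ℚ → ℚ → ℚ → Set
JacobiMadden a b c d =
  pow4 a + pow4 b + pow4 c + pow4 d Relation.Binary.PropositionalEquality.≡ pow4 (a + b + c + d)

Fq : ℚ → ℚ → ℚ
Fq a b = a * a + a * b + b * b

-- F = Fq a b, G = Fq c d, H = Fq (a+b) (c+d)

divBy : (p q : ℚ) → q ≢ 0ℚ → ℚ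
divBy p q q≢0 = _÷_ p q {{≢-nonZero q≢0}}

-- Write F = Fq a b, G = Fq c d and H = Fq (a+b) (c+d), where Fq x y = x² + xy + y².
-- The proof rests on three facts.
--   (1) A polynomial identity: (a+b+c+d)⁴ = a⁴ + b⁴ + c⁴ + d⁴ + 2(H² − F² − G²),
--       so every solution of the Jacobi–Madden equation satisfies H² = F² + G²,
--       i.e. (H + F)(H − F) = G².
--   (2) Fq is positive definite: 4·Fq x y = (2x+y)² + 3y², hence Fq x y ≥ 0, with
--       equality only for x = y = 0.  A non-trivial solution cannot have c = d = 0,
--       so G ≠ 0; then G² ≠ 0 forces H − F ≠ 0 and H + F ≠ 0.
--   (3) Field facts for ℚ: cross-multiplication p/q = r/s ⇔ ps = rq, and a quotient
--       of positive rationals is positive.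
module Submission where

open import Defs
open import Data.Nat using (_≥_)
open import Data.Rational using (ℚ; 0ℚ; _+_; _-_; _<_)
open import Data.Product using (Σ; _×_)
open import Relation.Binary.PropositionalEquality using (_≡_; _≢_)

open import Data.Rational
  using (1ℚ; _*_; _÷_; 1/_; _≤_; NonZero; Positive; ≢-nonZero; nonNegative; nonPositive; _≟_)
import Data.Rational.Properties as ℚ
open import Data.Rational.Solver using (module +-*-Solver)
open +-*-Solver
import Data.Nat as ℕ
import Data.Nat.Properties as ℕ
open import Data.Product using (_,_)
open import Data.Sum using (inj₁; inj₂)
open import Relation.Nullary using (yes; no; ¬_)
open import Relation.Binary.PropositionalEquality
  using (refl; sym; trans; cong; subst; subst₂; module ≡-Reasoning)
open ≡-Reasoning

zero-divisor : ∀ x y → x * y ≡ 0ℚ → y ≢ 0ℚ → x ≡ 0ℚ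
zero-divisor x y xy≡0 y≢0 = begin
  x                  ≡⟨ sym (ℚ.*-identityʳ x) ⟩
  x * 1ℚ             ≡⟨ cong (x *_) (sym (ℚ.*-inverseʳ y {{≢-nonZero y≢0}})) ⟩
  x * (y * y⁻¹)      ≡⟨ sym (ℚ.*-assoc x y y⁻¹) ⟩
  (x * y) * y⁻¹      ≡⟨ cong (_* y⁻¹) xy≡0 ⟩
  0ℚ * y⁻¹           ≡⟨ ℚ.*-zeroˡ y⁻¹ ⟩
  0ℚ                 ∎
  where
  y⁻¹ : ℚ
  y⁻¹ = (1/ y) {{≢-nonZero y≢0}}

square≡0⇒≡0 : ∀ x → x * x ≡ 0ℚ → x ≡ 0ℚ
square≡0⇒≡0 x xx≡0 with x ≟ 0ℚ
... | yes x≡0 = x≡0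
... | no  x≢0 = zero-divisor x x xx≡0 x≢0

÷-cross : ∀ p q r s .{{_ : NonZero q}} .{{_ : NonZero s}} →
          p * s ≡ r * q → p ÷ q ≡ r ÷ s
÷-cross p q r s ps≡rq = begin
  p * q⁻¹                       ≡⟨ sym (ℚ.*-identityʳ (p * q⁻¹)) ⟩
  p * q⁻¹ * 1ℚ                  ≡⟨ cong (p * q⁻¹ *_) (sym (ℚ.*-inverseʳ s)) ⟩
  p * q⁻¹ * (s * s⁻¹)           ≡⟨ solve 4 (λ p q⁻¹ s s⁻¹ → p :* q⁻¹ :* (s :* s⁻¹) := (p :* s) :* (q⁻¹ :* s⁻¹)) refl p q⁻¹ s s⁻¹ ⟩
  (p * s) * (q⁻¹ * s⁻¹)         ≡⟨ cong (_* (q⁻¹ * s⁻¹)) ps≡rq ⟩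
  (r * q) * (q⁻¹ * s⁻¹)         ≡⟨ solve 4 (λ r q q⁻¹ s⁻¹ → (r :* q) :* (q⁻¹ :* s⁻¹) := (q :* q⁻¹) :* (r :* s⁻¹)) refl r q q⁻¹ s⁻¹ ⟩
  (q * q⁻¹) * (r * s⁻¹)         ≡⟨ cong (_* (r * s⁻¹)) (ℚ.*-inverseʳ q) ⟩
  1ℚ * (r * s⁻¹)                ≡⟨ ℚ.*-identityˡ (r * s⁻¹) ⟩
  r * s⁻¹                       ∎
  where
  q⁻¹ s⁻¹ : ℚ
  q⁻¹ = 1/ q
  s⁻¹ = 1/ s

÷-pos : ∀ p q .{{_ : Positive p}} .{{_ : Positive q}} →
        0ℚ < (p ÷ q) {{ℚ.pos⇒nonZero q}}
÷-pos p q = ℚ.positive⁻¹ _ {{ℚ.pos*pos⇒pos p _ {{ℚ.1/pos⇒pos q}}}}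

nonNeg∧≢0⇒pos : ∀ x → 0ℚ ≤ x → x ≢ 0ℚ → Positive x
nonNeg∧≢0⇒pos x 0≤x x≢0 = ℚ.nonNeg∧nonZero⇒pos x {{nonNegative 0≤x}} {{≢-nonZero x≢0}}

square-nonNeg : ∀ x → 0ℚ ≤ x * x
square-nonNeg x with ℚ.≤-total 0ℚ x
... | inj₁ 0≤x = ℚ.nonNegative⁻¹ _
  {{ℚ.nonNeg*nonNeg⇒nonNeg x {{nonNegative 0≤x}} x {{nonNegative 0≤x}}}}
... | inj₂ x≤0 = ℚ.nonNegative⁻¹ _
  {{ℚ.nonPos*nonPos⇒nonPos x {{nonPositive x≤0}} x {{nonPositive x≤0}}}}

+-nonNeg : ∀ {p q} → 0ℚ ≤ p → 0ℚ ≤ q → 0ℚ ≤ p + q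
+-nonNeg {p} {q} 0≤p 0≤q = ℚ.nonNegative⁻¹ _
  {{ℚ.nonNeg+nonNeg⇒nonNeg p {{nonNegative 0≤p}} q {{nonNegative 0≤q}}}}

+-nonNeg-zeroʳ : ∀ {p q} → 0ℚ ≤ p → 0ℚ ≤ q → p + q ≡ 0ℚ → q ≡ 0ℚ
+-nonNeg-zeroʳ {p} {q} 0≤p 0≤q p+q≡0 = ℚ.≤-antisym q≤0 0≤q
  where
  q≤p+q : q ≤ p + q
  q≤p+q = subst (_≤ p + q) (ℚ.+-identityˡ q) (ℚ.+-monoˡ-≤ q 0≤p)
  q≤0 : q ≤ 0ℚ
  q≤0 = subst (q ≤_) p+q≡0 q≤p+q

-- The constant 4, the scaling that clears denominators when completing the square.
four : ℚ
four = 1ℚ + 1ℚ + 1ℚ + 1ℚ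

Fq-completeSquare : ∀ x y →
  four * Fq x y ≡ ((x + x + y) * (x + x + y) + y * y + y * y) + y * y
Fq-completeSquare = solve 2 (λ x y →
  (con 1ℚ :+ con 1ℚ :+ con 1ℚ :+ con 1ℚ) :* (x :* x :+ x :* y :+ y :* y)
    := ((x :+ x :+ y) :* (x :+ x :+ y) :+ y :* y :+ y :* y) :+ y :* y) refl

leadingSquares-nonNeg : ∀ x y → 0ℚ ≤ (x + x + y) * (x + x + y) + y * y + y * y
leadingSquares-nonNeg x y =
  +-nonNeg (+-nonNeg (square-nonNeg (x + x + y)) (square-nonNeg y)) (square-nonNeg y)

Fq-nonNeg : ∀ x y → 0ℚ ≤ Fq x y
Fq-nonNeg x y = ℚ.*-cancelˡ-≤-pos four (subst₂ _≤_ (sym (ℚ.*-zeroʳ four)) (sym (Fq-completeSquare x y))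
  (+-nonNeg (leadingSquares-nonNeg x y) (square-nonNeg y)))

-- Fq is symmetric, so definiteness in y yields definiteness in x.
Fq-sym : ∀ x y → Fq y x ≡ Fq x y
Fq-sym = solve 2 (λ x y → y :* y :+ y :* x :+ x :* x := x :* x :+ x :* y :+ y :* y) refl

Fq≡0⇒y≡0 : ∀ x y → Fq x y ≡ 0ℚ → y ≡ 0ℚ
Fq≡0⇒y≡0 x y Fq≡0 = square≡0⇒≡0 y
  (+-nonNeg-zeroʳ (leadingSquares-nonNeg x y) (square-nonNeg y) (begin
    _             ≡⟨ sym (Fq-completeSquare x y) ⟩
    four * Fq x y ≡⟨ cong (four *_) Fq≡0 ⟩
    four * 0ℚ     ≡⟨ ℚ.*-zeroʳ four ⟩
    0ℚ            ∎))

Fq≡0⇒x≡0 : ∀ x y → Fq x y ≡ 0ℚ → x ≡ 0ℚ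
Fq≡0⇒x≡0 x y Fq≡0 = Fq≡0⇒y≡0 y x (trans (Fq-sym x y) Fq≡0)

nz≤1 : ∀ x → nz x ℕ.≤ 1
nz≤1 x with x ≟ 0ℚ
... | yes _ = ℕ.z≤n
... | no  _ = ℕ.s≤s ℕ.z≤n

trivialTail : ∀ a b → ¬ (numNonZero a b 0ℚ 0ℚ ≥ 3)
trivialTail a b ≥3 = ℕ.<-irrefl refl (ℕ.≤-trans 3≤ (ℕ.+-mono-≤ (nz≤1 a) (nz≤1 b)))
  where
  3≤ : 3 ℕ.≤ nz a ℕ.+ nz b
  3≤ = subst (3 ℕ.≤_) (trans (ℕ.+-identityʳ _) (ℕ.+-identityʳ _)) ≥3

nonTrivial⇒G≢0 : ∀ a b c d → numNonZero a b c d ≥ 3 → Fq c d ≢ 0ℚ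
nonTrivial⇒G≢0 a b c d ≥3 G≡0 = trivialTail a b
  (subst₂ (λ c d → numNonZero a b c d ≥ 3) (Fq≡0⇒x≡0 c d G≡0) (Fq≡0⇒y≡0 c d G≡0) ≥3)

quarticExpansion : ∀ a b c d →
  let F = Fq a b; G = Fq c d; H = Fq (a + b) (c + d) in
  pow4 (a + b + c + d)
    ≡ (pow4 a + pow4 b + pow4 c + pow4 d) + (H * H - (F * F + G * G)) * (1ℚ + 1ℚ)
quarticExpansion = solve 4 (λ a b c d →
  let F = a :* a :+ a :* b :+ b :* b
      G = c :* c :+ c :* d :+ d :* d
      H = (a :+ b) :* (a :+ b) :+ (a :+ b) :* (c :+ d) :+ (c :+ d) :* (c :+ d)
      p4 = λ x → x :* x :* x :* x
  in p4 (a :+ b :+ c :+ d)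
       := (p4 a :+ p4 b :+ p4 c :+ p4 d) :+ (H :* H :- (F :* F :+ G :* G)) :* (con 1ℚ :+ con 1ℚ)) refl

jacobiMadden⇒pythagorean : ∀ a b c d → JacobiMadden a b c d →
  Fq (a + b) (c + d) * Fq (a + b) (c + d) ≡ Fq a b * Fq a b + Fq c d * Fq c d
jacobiMadden⇒pythagorean a b c d jm = begin
  H * H                   ≡⟨ solve 2 (λ X K → X := (X :- K) :+ K) refl (H * H) (F * F + G * G) ⟩
  D + (F * F + G * G)     ≡⟨ cong (_+ (F * F + G * G)) D≡0 ⟩
  0ℚ + (F * F + G * G)    ≡⟨ ℚ.+-identityˡ _ ⟩
  F * F + G * G           ∎
  where
  F G H D S : ℚ
  F = Fq a b
  G = Fq c d
  H = Fq (a + b) (c + d)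
  D = H * H - (F * F + G * G)
  S = pow4 a + pow4 b + pow4 c + pow4 d
  2D≡0 : D * (1ℚ + 1ℚ) ≡ 0ℚ
  2D≡0 = begin
    D * (1ℚ + 1ℚ)                          ≡⟨ solve 2 (λ S E → E := (S :+ E) :- S) refl S (D * (1ℚ + 1ℚ)) ⟩
    (S + D * (1ℚ + 1ℚ)) - S                ≡⟨ cong (_- S) (sym (quarticExpansion a b c d)) ⟩
    pow4 (a + b + c + d) - S               ≡⟨ cong (_- S) (sym jm) ⟩
    S - S                                  ≡⟨ ℚ.+-inverseʳ S ⟩
    0ℚ                                     ∎
  D≡0 : D ≡ 0ℚ
  D≡0 = zero-divisor D (1ℚ + 1ℚ) 2D≡0 (λ ())

differenceOfSquares : ∀ H F G → H * H ≡ F * F + G * G → (H + F) * (H - F) ≡ G * G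
differenceOfSquares H F G H²≡F²+G² = begin
  (H + F) * (H - F)        ≡⟨ solve 2 (λ H F → (H :+ F) :* (H :- F) := H :* H :- F :* F) refl H F ⟩
  H * H - F * F            ≡⟨ cong (_- F * F) H²≡F²+G² ⟩
  (F * F + G * G) - F * F  ≡⟨ solve 2 (λ F G → (F :* F :+ G :* G) :- F :* F := G :* G) refl F G ⟩
  G * G                    ∎

mainTheorem1 : (a b c d : ℚ) → JacobiMadden a b c d → numNonZero a b c d ≥ 3 →
    Σ (Fq c d ≢ 0ℚ) λ G≢0 → Σ (Fq (a + b) (c + d) - Fq a b ≢ 0ℚ) λ HF≢0 →
    (divBy (Fq (a + b) (c + d) + Fq a b) (Fq c d) G≢0
    ≡ divBy (Fq c d) (Fq (a + b) (c + d) - Fq a b) HF≢0)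
    × (0ℚ < divBy (Fq (a + b) (c + d) + Fq a b) (Fq c d) G≢0)
mainTheorem1 a b c d jm nonTrivial = G≢0 , H-F≢0 , t-agrees , t-pos
  where
  F G H : ℚ
  F = Fq a b
  G = Fq c d
  H = Fq (a + b) (c + d)
  G≢0 : G ≢ 0ℚ
  G≢0 = nonTrivial⇒G≢0 a b c d nonTrivial
  [H+F][H-F]≡G² : (H + F) * (H - F) ≡ G * G
  [H+F][H-F]≡G² = differenceOfSquares H F G (jacobiMadden⇒pythagorean a b c d jm)
  G²≢0 : G * G ≢ 0ℚ
  G²≢0 G²≡0 = G≢0 (square≡0⇒≡0 G G²≡0)
  H-F≢0 : H - F ≢ 0ℚ
  H-F≢0 H-F≡0 = G²≢0 (trans (sym [H+F][H-F]≡G²) (trans (cong ((H + F) *_) H-F≡0) (ℚ.*-zeroʳ (H + F))))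
  H+F≢0 : H + F ≢ 0ℚ
  H+F≢0 H+F≡0 = G²≢0 (trans (sym [H+F][H-F]≡G²) (trans (cong (_* (H - F)) H+F≡0) (ℚ.*-zeroˡ (H - F))))
  t-agrees : divBy (H + F) G G≢0 ≡ divBy G (H - F) H-F≢0
  t-agrees = ÷-cross (H + F) G G (H - F) {{≢-nonZero G≢0}} {{≢-nonZero H-F≢0}} [H+F][H-F]≡G²
  t-pos : 0ℚ < divBy (H + F) G G≢0
  t-pos = ÷-pos (H + F) G
    {{nonNeg∧≢0⇒pos (H + F) (+-nonNeg (Fq-nonNeg (a + b) (c + d)) (Fq-nonNeg a b)) H+F≢0}}
    {{nonNeg∧≢0⇒pos G (Fq-nonNeg c d) G≢0}}
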